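{- Let $m\ge1$ and define $\binom{n}{k}_m$ for $0\le k\le n$ by $\binom{n}{0}_m=1$, $\binom{n}{n}_m=\delta_{n\bmod m,0}$ (for all $n\ge0$), and $\binom{n}{k}_m=\binom{n-1}{k}_m+\binom{n-1}{k-1}_m$ for $0<k<n$. Then $\binom{n}{k}_m=[x^ny^k]\,g_m(x,y)$ for all $0\le k\le n$, where \[ g_m(x,y)=\frac{1-xy}{(1-(xy)^m)(1-x-xy)}=\frac{1}{(1+xy+\cdots+(xy)^{m-1})(1-x-xy)}. \]
   Context: $\delta_{i,j}$ is $1$ if $i=j$ and $0$ otherwise; $[x^ny^k]$ extracts the coefficient of $x^ny^k$ in a bivariate power series. -}

module Defs where

open import Data.Nat using (ℕ; zero; suc; _<?_; _∸_)
import Data.Nat as ℕ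
open import Data.Nat.Divisibility using (_∣?_)
open import Data.Integer using (ℤ; +_; _+_; _-_; _*_)
open import Relation.Nullary using (yes; no)
open import Relation.Binary.PropositionalEquality using (_≡_)

-- For k > n we return 0 (never used by the statement, which requires k ≤ n).
-- δ_{n mod m, 0} is rendered as the test  m ∣ n  (equivalent for m ≥ 1).
mbinom : ℕ → ℕ → ℕ → ℕ
mbinom m n       zero    = 1
mbinom m zero    (suc k) = 0
mbinom m (suc n) (suc k) with k ℕ.≟ n
... | yes _ with m ∣? suc n
...   | yes _ = 1
...   | no  _ = 0
mbinom m (suc n) (suc k) | no _ with k <? n
...   | yes _ = mbinom m n (suc k) ℕ.+ mbinom m n k
...   | no  _ = 0

-- Formal bivariate power series over ℤ: s n k is the coefficient of x^n y^k.
Series : Set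
Series = ℕ → ℕ → ℤ

sumTo : ℕ → (ℕ → ℤ) → ℤ
sumTo zero    f = f 0
sumTo (suc n) f = sumTo n f + f (suc n)

δ : ℕ → ℕ → ℤ
δ i j with i ℕ.≟ j
... | yes _ = + 1
... | no  _ = + 0

mono : ℕ → ℕ → Series
mono a b n k = δ n a * δ k b

one : Series
one = mono 0 0

_⊖_ : Series → Series → Series
(f ⊖ g) n k = f n k - g n k

_⊛_ : Series → Series → Series
(f ⊛ g) n k = sumTo n λ i → sumTo k λ j → f i j * g (n ∸ i) (k ∸ j)

infixl 6 _⊖_
infixl 7 _⊛_
infix 4 _≈ₛ_

_≈ₛ_ : Series → Series → Set
f ≈ₛ g = ∀ n k → f n k ≡ g n k

numer : Series
numer = one ⊖ mono 1 1

denom : ℕ → Series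
denom m = (one ⊖ mono m m) ⊛ (one ⊖ mono 1 0 ⊖ mono 1 1)

-- g is the power series g_m = numer / denom  (denom has constant term 1 for m ≥ 1,
-- so such g exists and is unique):
IsGm : ℕ → Series → Set
IsGm m g = g ⊛ denom m ≈ₛ numer

module Submission where

-- Put F = g (1 - x - xy).  Multiplication by (xy)^m commutes with the Cauchy
-- product, so g (1 - (xy)^m) (1 - x - xy) = 1 - xy becomes F = 1 - xy + (xy)^m F.
-- Strong induction on the x-degree then shows that F vanishes off the diagonal
-- and that F(j,j) = [m | j] - [m | j - 1] (with [m | -1] = 0).  Read backwards,
-- g = F + x g + xy g is Pascal's rule corrected by F: the correction is absent
-- below the diagonal and on it turns g(n,n) into [m | n], which is exactly the
-- recursion defining the m-binomials.

open import Data.Integer as ℤ using (ℤ; +_; _+_; _-_; _*_)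
import Data.Integer.Properties as ℤ
open import Data.Integer.Tactic.RingSolver using (solve-∀)
open import Data.Nat as ℕ using (ℕ; zero; suc; _≤_; _<_; _∸_; z≤n; s≤s; _≤?_)
import Data.Nat.Properties as ℕ
open import Data.Nat.Divisibility using (_∣_; _∣?_; _∣0; ∣-refl; ∣⇒≤; ∣m∣n⇒∣m+n; ∣m+n∣m⇒∣n)
open import Data.Nat.Induction using (<-rec)
open import Data.Sum using (inj₁; inj₂)
open import Relation.Binary.Definitions using (tri<; tri≈; tri>)
open import Function using (_∘_)
open import Relation.Binary.PropositionalEquality
open import Relation.Nullary using (Dec; yes; no; ¬_; contradiction)

open import Defs

open ≡-Reasoning

sumTo-cong : ∀ n {f h : ℕ → ℤ} → (∀ i → i ≤ n → f i ≡ h i) → sumTo n f ≡ sumTo n h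
sumTo-cong zero    f≗h = f≗h 0 z≤n
sumTo-cong (suc n) f≗h =
  cong₂ _+_ (sumTo-cong n (λ i i≤n → f≗h i (ℕ.m≤n⇒m≤1+n i≤n))) (f≗h (suc n) ℕ.≤-refl)

sumTo-zero : ∀ n {f : ℕ → ℤ} → (∀ i → i ≤ n → f i ≡ + 0) → sumTo n f ≡ + 0
sumTo-zero zero    f≗0 = f≗0 0 z≤n
sumTo-zero (suc n) f≗0 =
  cong₂ _+_ (sumTo-zero n (λ i i≤n → f≗0 i (ℕ.m≤n⇒m≤1+n i≤n))) (f≗0 (suc n) ℕ.≤-refl)

sumTo-minus : ∀ n (f h : ℕ → ℤ) → sumTo n (λ i → f i - h i) ≡ sumTo n f - sumTo n h
sumTo-minus zero    f h = refl
sumTo-minus (suc n) f h = begin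
  sumTo n (λ i → f i - h i) + (f (suc n) - h (suc n)) ≡⟨ cong (_+ (f (suc n) - h (suc n))) (sumTo-minus n f h) ⟩
  (sumTo n f - sumTo n h) + (f (suc n) - h (suc n))   ≡⟨ interchange (sumTo n f) (sumTo n h) (f (suc n)) (h (suc n)) ⟩
  (sumTo n f + f (suc n)) - (sumTo n h + h (suc n))   ∎
  where
  interchange : ∀ a b c d → (a - b) + (c - d) ≡ (a + c) - (b + d)
  interchange = solve-∀

sumTo-*ˡ : ∀ n c (f : ℕ → ℤ) → sumTo n (λ i → c * f i) ≡ c * sumTo n f
sumTo-*ˡ zero    c f = refl
sumTo-*ˡ (suc n) c f =
  trans (cong (_+ c * f (suc n)) (sumTo-*ˡ n c f)) (sym (ℤ.*-distribˡ-+ c (sumTo n f) (f (suc n))))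

sumTo-head : ∀ n (f : ℕ → ℤ) → sumTo (suc n) f ≡ f 0 + sumTo n (f ∘ suc)
sumTo-head zero    f = refl
sumTo-head (suc n) f =
  trans (cong (_+ f (2 ℕ.+ n)) (sumTo-head n f)) (ℤ.+-assoc (f 0) (sumTo n (f ∘ suc)) _)

sumTo-reverse : ∀ n (f : ℕ → ℤ) → sumTo n (λ i → f (n ∸ i)) ≡ sumTo n f
sumTo-reverse zero    f = refl
sumTo-reverse (suc n) f = begin
  sumTo (suc n) (λ i → f (suc n ∸ i))  ≡⟨ sumTo-head n _ ⟩
  f (suc n) + sumTo n (λ i → f (n ∸ i)) ≡⟨ cong (_+_ (f (suc n))) (sumTo-reverse n f) ⟩
  f (suc n) + sumTo n f                 ≡⟨ ℤ.+-comm (f (suc n)) _ ⟩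
  sumTo (suc n) f                       ∎

sumTo-truncate : ∀ n {p} {f : ℕ → ℤ} → p ≤ n → (∀ i → p < i → i ≤ n → f i ≡ + 0) →
                 sumTo n f ≡ sumTo p f
sumTo-truncate n p≤n f≗0 with ℕ.m≤n⇒m<n∨m≡n p≤n
... | inj₂ refl = refl
sumTo-truncate (suc n) {p} {f} _ f≗0 | inj₁ (s≤s p≤n) = begin
  sumTo n f + f (suc n) ≡⟨ cong₂ _+_ (sumTo-truncate n p≤n (λ i p<i i≤n → f≗0 i p<i (ℕ.m≤n⇒m≤1+n i≤n)))
                                     (f≗0 (suc n) (s≤s p≤n) ℕ.≤-refl) ⟩
  sumTo p f + + 0       ≡⟨ ℤ.+-identityʳ _ ⟩
  sumTo p f             ∎

δ-refl : ∀ i → δ i i ≡ + 1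
δ-refl i with i ℕ.≟ i
... | yes _   = refl
... | no  i≢i = contradiction refl i≢i

δ-≢ : ∀ {i j} → i ≢ j → δ i j ≡ + 0
δ-≢ {i} {j} i≢j with i ℕ.≟ j
... | yes i≡j = contradiction i≡j i≢j
... | no  _   = refl

sumTo-δ-beyond : ∀ n {a} (h : ℕ → ℤ) → n < a → sumTo n (λ i → δ i a * h i) ≡ + 0
sumTo-δ-beyond n h n<a =
  sumTo-zero n (λ i i≤n → cong (_* h i) (δ-≢ (ℕ.<⇒≢ (ℕ.≤-<-trans i≤n n<a))))

sumTo-δ : ∀ n {a} (h : ℕ → ℤ) → a ≤ n → sumTo n (λ i → δ i a * h i) ≡ h a
sumTo-δ zero h z≤n = trans (cong (_* h 0) (δ-refl 0)) (ℤ.*-identityˡ (h 0))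
sumTo-δ (suc n) {a} h a≤1+n with ℕ.m≤n⇒m<n∨m≡n a≤1+n
... | inj₁ a<1+n@(s≤s a≤n) = begin
  sumTo n (λ i → δ i a * h i) + δ (suc n) a * h (suc n)
    ≡⟨ cong₂ _+_ (sumTo-δ n h a≤n) (cong (_* h (suc n)) (δ-≢ (≢-sym (ℕ.<⇒≢ a<1+n)))) ⟩
  h a + + 0
    ≡⟨ ℤ.+-identityʳ (h a) ⟩
  h a ∎
... | inj₂ refl = begin
  sumTo n (λ i → δ i a * h i) + δ a a * h a
    ≡⟨ cong₂ _+_ (sumTo-δ-beyond n h ℕ.≤-refl) (cong (_* h a) (δ-refl a)) ⟩
  + 0 + + 1 * h a
    ≡⟨ trans (ℤ.+-identityˡ _) (ℤ.*-identityˡ (h a)) ⟩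
  h a ∎

shift : ℕ → ℕ → Series → Series
shift a b f n k with a ≤? n | b ≤? k
... | yes _ | yes _ = f (n ∸ a) (k ∸ b)
... | _     | _     = + 0

module _ (a b : ℕ) (f : Series) {n k : ℕ} where

  shift-≤ : a ≤ n → b ≤ k → shift a b f n k ≡ f (n ∸ a) (k ∸ b)
  shift-≤ a≤n b≤k with a ≤? n | b ≤? k
  ... | yes _   | yes _   = refl
  ... | no  a≰n | _       = contradiction a≤n a≰n
  ... | yes _   | no  b≰k = contradiction b≤k b≰k

  shift-≰ˡ : ¬ a ≤ n → shift a b f n k ≡ + 0
  shift-≰ˡ a≰n with a ≤? n | b ≤? k
  ... | yes a≤n | _     = contradiction a≤n a≰n
  ... | no  _   | _     = refl

  shift-≰ʳ : ¬ b ≤ k → shift a b f n k ≡ + 0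
  shift-≰ʳ b≰k with a ≤? n | b ≤? k
  ... | _     | yes b≤k = contradiction b≤k b≰k
  ... | yes _ | no  _   = refl
  ... | no  _ | no  _   = refl

shift-zero : ∀ f → shift 0 0 f ≈ₛ f
shift-zero f n k = shift-≤ 0 0 f z≤n z≤n

mono-⊛ : ∀ a b f → mono a b ⊛ f ≈ₛ shift a b f
mono-⊛ a b f n k =
  trans (sumTo-cong n (λ i _ → factor i)) (pick (a ≤? n) (b ≤? k))
  where
  column : ℕ → ℤ
  column i = sumTo k (λ j → δ j b * f (n ∸ i) (k ∸ j))

  factor : ∀ i → sumTo k (λ j → (δ i a * δ j b) * f (n ∸ i) (k ∸ j)) ≡ δ i a * column i
  factor i = trans (sumTo-cong k (λ j _ → ℤ.*-assoc (δ i a) (δ j b) _))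
                   (sumTo-*ˡ k (δ i a) (λ j → δ j b * f (n ∸ i) (k ∸ j)))

  pick : Dec (a ≤ n) → Dec (b ≤ k) → sumTo n (λ i → δ i a * column i) ≡ shift a b f n k
  pick (yes a≤n) (yes b≤k) = begin
    sumTo n (λ i → δ i a * column i) ≡⟨ sumTo-δ n column a≤n ⟩
    column a                          ≡⟨ sumTo-δ k _ b≤k ⟩
    f (n ∸ a) (k ∸ b)                 ≡⟨ shift-≤ a b f a≤n b≤k ⟨
    shift a b f n k                   ∎
  pick (yes a≤n) (no b≰k) = begin
    sumTo n (λ i → δ i a * column i) ≡⟨ sumTo-δ n column a≤n ⟩
    column a                          ≡⟨ sumTo-δ-beyond k _ (ℕ.≰⇒> b≰k) ⟩
    + 0                               ≡⟨ shift-≰ʳ a b f b≰k ⟨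
    shift a b f n k                   ∎
  pick (no a≰n) _ =
    trans (sumTo-δ-beyond n column (ℕ.≰⇒> a≰n)) (sym (shift-≰ˡ a b f a≰n))

one-⊛ : ∀ f → one ⊛ f ≈ₛ f
one-⊛ f n k = trans (mono-⊛ 0 0 f n k) (shift-zero f n k)

⊛-comm : ∀ f g → f ⊛ g ≈ₛ g ⊛ f
⊛-comm f g n k = begin
  (f ⊛ g) n k
    ≡⟨ sumTo-cong n (λ i i≤n → sumTo-cong k (λ j j≤k → swap i≤n j≤k)) ⟩
  sumTo n (λ i → sumTo k (λ j → g (n ∸ i) (k ∸ j) * f (n ∸ (n ∸ i)) (k ∸ (k ∸ j))))
    ≡⟨ sumTo-cong n (λ i _ → sumTo-reverse k (λ j → g (n ∸ i) j * f (n ∸ (n ∸ i)) (k ∸ j))) ⟩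
  sumTo n (λ i → sumTo k (λ j → g (n ∸ i) j * f (n ∸ (n ∸ i)) (k ∸ j)))
    ≡⟨ sumTo-reverse n (λ i → sumTo k (λ j → g i j * f (n ∸ i) (k ∸ j))) ⟩
  (g ⊛ f) n k ∎
  where
  swap : ∀ {i j} → i ≤ n → j ≤ k →
         f i j * g (n ∸ i) (k ∸ j) ≡ g (n ∸ i) (k ∸ j) * f (n ∸ (n ∸ i)) (k ∸ (k ∸ j))
  swap {i} {j} i≤n j≤k = trans (ℤ.*-comm (f i j) (g (n ∸ i) (k ∸ j)))
    (cong₂ (λ i′ j′ → g (n ∸ i) (k ∸ j) * f i′ j′) (sym (ℕ.m∸[m∸n]≡n i≤n)) (sym (ℕ.m∸[m∸n]≡n j≤k)))

⊛-distribʳ-⊖ : ∀ f g h → (f ⊖ g) ⊛ h ≈ₛ f ⊛ h ⊖ g ⊛ h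
⊛-distribʳ-⊖ f g h n k = begin
  sumTo n (λ i → sumTo k (λ j → (f i j - g i j) * h (n ∸ i) (k ∸ j)))
    ≡⟨ sumTo-cong n (λ i _ → trans (sumTo-cong k (λ j _ → *-distribʳ-minus (f i j) (g i j) (h (n ∸ i) (k ∸ j))))
                                   (sumTo-minus k (λ j → f i j * h (n ∸ i) (k ∸ j)) (λ j → g i j * h (n ∸ i) (k ∸ j)))) ⟩
  sumTo n (λ i → sumTo k (λ j → f i j * h (n ∸ i) (k ∸ j)) - sumTo k (λ j → g i j * h (n ∸ i) (k ∸ j)))
    ≡⟨ sumTo-minus n (λ i → sumTo k (λ j → f i j * h (n ∸ i) (k ∸ j)))
                     (λ i → sumTo k (λ j → g i j * h (n ∸ i) (k ∸ j))) ⟩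
  (f ⊛ h) n k - (g ⊛ h) n k ∎
  where
  *-distribʳ-minus : ∀ x y z → (x - y) * z ≡ x * z - y * z
  *-distribʳ-minus = solve-∀

⊛-distribˡ-⊖ : ∀ f g h → f ⊛ (g ⊖ h) ≈ₛ f ⊛ g ⊖ f ⊛ h
⊛-distribˡ-⊖ f g h n k = begin
  (f ⊛ (g ⊖ h)) n k            ≡⟨ ⊛-comm f (g ⊖ h) n k ⟩
  ((g ⊖ h) ⊛ f) n k            ≡⟨ ⊛-distribʳ-⊖ g h f n k ⟩
  (g ⊛ f) n k - (h ⊛ f) n k    ≡⟨ cong₂ _-_ (⊛-comm g f n k) (⊛-comm h f n k) ⟩
  (f ⊛ g) n k - (f ⊛ h) n k    ∎

⊛-congʳ : ∀ f {g h} → g ≈ₛ h → f ⊛ g ≈ₛ f ⊛ h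
⊛-congʳ f g≈h n k =
  sumTo-cong n (λ i _ → sumTo-cong k (λ j _ → cong (f i j *_) (g≈h (n ∸ i) (k ∸ j))))

private
  ≤∸-swap : ∀ {n i a} → i ≤ n → a ≤ n ∸ i → i ≤ n ∸ a
  ≤∸-swap {n} {i} {a} i≤n a≤n∸i =
    ℕ.m+n≤o⇒m≤o∸n i (subst (_≤ n) (ℕ.+-comm a i) (ℕ.m≤o∸n⇒m+n≤o a i≤n a≤n∸i))

  ∸-∸-comm : ∀ n i a → n ∸ i ∸ a ≡ n ∸ a ∸ i
  ∸-∸-comm n i a = begin
    n ∸ i ∸ a     ≡⟨ ℕ.∸-+-assoc n i a ⟩
    n ∸ (i ℕ.+ a) ≡⟨ cong (n ∸_) (ℕ.+-comm i a) ⟩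
    n ∸ (a ℕ.+ i) ≡⟨ ℕ.∸-+-assoc n a i ⟨
    n ∸ a ∸ i     ∎

⊛-shift : ∀ a b f g → f ⊛ shift a b g ≈ₛ shift a b (f ⊛ g)
⊛-shift a b f g n k = cases (a ≤? n) (b ≤? k)
  where
  term : ℕ → ℕ → ℤ
  term i j = f i j * shift a b g (n ∸ i) (k ∸ j)

  term-≰ˡ : ∀ i j → ¬ a ≤ n ∸ i → term i j ≡ + 0
  term-≰ˡ i j a≰n∸i = trans (cong (f i j *_) (shift-≰ˡ a b g a≰n∸i)) (ℤ.*-zeroʳ (f i j))

  term-≰ʳ : ∀ i j → ¬ b ≤ k ∸ j → term i j ≡ + 0
  term-≰ʳ i j b≰k∸j = trans (cong (f i j *_) (shift-≰ʳ a b g b≰k∸j)) (ℤ.*-zeroʳ (f i j))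

  row : ℕ → ℤ
  row i = sumTo k (term i)

  row-within : a ≤ n → b ≤ k → ∀ i → i ≤ n ∸ a →
               row i ≡ sumTo (k ∸ b) (λ j → f i j * g (n ∸ a ∸ i) (k ∸ b ∸ j))
  row-within a≤n b≤k i i≤n∸a = begin
    sumTo k (term i)       ≡⟨ sumTo-truncate k (ℕ.m∸n≤m k b) (λ j k∸b<j j≤k →
                                term-≰ʳ i j (ℕ.<⇒≱ k∸b<j ∘ ≤∸-swap j≤k)) ⟩
    sumTo (k ∸ b) (term i) ≡⟨ sumTo-cong (k ∸ b) (λ j j≤k∸b → cong (f i j *_) (shifted j≤k∸b)) ⟩
    sumTo (k ∸ b) (λ j → f i j * g (n ∸ a ∸ i) (k ∸ b ∸ j)) ∎
    where
    shifted : ∀ {j} → j ≤ k ∸ b → shift a b g (n ∸ i) (k ∸ j) ≡ g (n ∸ a ∸ i) (k ∸ b ∸ j)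
    shifted {j} j≤k∸b = trans
      (shift-≤ a b g (≤∸-swap a≤n i≤n∸a) (≤∸-swap b≤k j≤k∸b))
      (cong₂ g (∸-∸-comm n i a) (∸-∸-comm k j b))

  cases : Dec (a ≤ n) → Dec (b ≤ k) → (f ⊛ shift a b g) n k ≡ shift a b (f ⊛ g) n k
  cases (yes a≤n) (yes b≤k) = begin
    sumTo n row             ≡⟨ sumTo-truncate n (ℕ.m∸n≤m n a) (λ i n∸a<i i≤n →
                                 sumTo-zero k (λ j _ → term-≰ˡ i j (ℕ.<⇒≱ n∸a<i ∘ ≤∸-swap i≤n))) ⟩
    sumTo (n ∸ a) row       ≡⟨ sumTo-cong (n ∸ a) (row-within a≤n b≤k) ⟩
    (f ⊛ g) (n ∸ a) (k ∸ b) ≡⟨ shift-≤ a b (f ⊛ g) a≤n b≤k ⟨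
    shift a b (f ⊛ g) n k   ∎
  cases (no a≰n) _ = trans
    (sumTo-zero n (λ i _ → sumTo-zero k (λ j _ → term-≰ˡ i j (λ a≤n∸i → a≰n (ℕ.≤-trans a≤n∸i (ℕ.m∸n≤m n i))))))
    (sym (shift-≰ˡ a b (f ⊛ g) a≰n))
  cases (yes _) (no b≰k) = trans
    (sumTo-zero n (λ i _ → sumTo-zero k (λ j _ → term-≰ʳ i j (λ b≤k∸j → b≰k (ℕ.≤-trans b≤k∸j (ℕ.m∸n≤m k j))))))
    (sym (shift-≰ʳ a b (f ⊛ g) b≰k))

pascal : Series
pascal = one ⊖ mono 1 0 ⊖ mono 1 1

⊛-pascal : ∀ f → f ⊛ pascal ≈ₛ f ⊖ shift 1 0 f ⊖ shift 1 1 f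
⊛-pascal f n k = begin
  (f ⊛ pascal) n k
    ≡⟨ ⊛-comm f pascal n k ⟩
  (pascal ⊛ f) n k
    ≡⟨ ⊛-distribʳ-⊖ (one ⊖ mono 1 0) (mono 1 1) f n k ⟩
  ((one ⊖ mono 1 0) ⊛ f) n k - (mono 1 1 ⊛ f) n k
    ≡⟨ cong (_- (mono 1 1 ⊛ f) n k) (⊛-distribʳ-⊖ one (mono 1 0) f n k) ⟩
  (one ⊛ f) n k - (mono 1 0 ⊛ f) n k - (mono 1 1 ⊛ f) n k
    ≡⟨ cong₂ _-_ (cong₂ _-_ (one-⊛ f n k) (mono-⊛ 1 0 f n k)) (mono-⊛ 1 1 f n k) ⟩
  f n k - shift 1 0 f n k - shift 1 1 f n k ∎

denom≈pascal⊖shift : ∀ m → denom m ≈ₛ pascal ⊖ shift m m pascal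
denom≈pascal⊖shift m n k = begin
  ((one ⊖ mono m m) ⊛ pascal) n k
    ≡⟨ ⊛-distribʳ-⊖ one (mono m m) pascal n k ⟩
  (one ⊛ pascal) n k - (mono m m ⊛ pascal) n k
    ≡⟨ cong₂ _-_ (one-⊛ pascal n k) (mono-⊛ m m pascal n k) ⟩
  pascal n k - shift m m pascal n k ∎

numer-offdiag : ∀ {n k} → n ≢ k → numer n k ≡ + 0
numer-offdiag {n} {k} n≢k = cong₂ _-_ (δδ 0) (δδ 1)
  where
  δδ : ∀ c → δ n c * δ k c ≡ + 0
  δδ c with n ℕ.≟ c
  ... | yes refl = cong (+ 1 *_) (δ-≢ (≢-sym n≢k))
  ... | no  _    = refl

numer-diag-≥2 : ∀ {j} → 2 ≤ j → numer j j ≡ + 0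
numer-diag-≥2 (s≤s (s≤s _)) = refl

𝟙[_∣_] : ℕ → ℕ → ℤ
𝟙[ m ∣ n ] with m ∣? n
... | yes _ = + 1
... | no  _ = + 0

𝟙[_∣_-1] : ℕ → ℕ → ℤ
𝟙[ m ∣ zero  -1] = + 0
𝟙[ m ∣ suc n -1] = 𝟙[ m ∣ n ]

𝟙∣0 : ∀ m → 𝟙[ m ∣ 0 ] ≡ + 1
𝟙∣0 m with m ∣? 0
... | yes _   = refl
... | no  m∤0 = contradiction (m ∣0) m∤0

𝟙∣-periodic : ∀ m n → 𝟙[ m ∣ n ℕ.+ m ] ≡ 𝟙[ m ∣ n ]
𝟙∣-periodic m n with m ∣? n ℕ.+ m | m ∣? n
... | yes _     | yes _   = refl
... | no  _     | no  _   = refl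
... | yes m∣n+m | no  m∤n = contradiction (∣m+n∣m⇒∣n (subst (m ∣_) (ℕ.+-comm n m) m∣n+m) ∣-refl) m∤n
... | no  m∤n+m | yes m∣n = contradiction (∣m∣n⇒∣m+n m∣n ∣-refl) m∤n+m

𝟙∣-< : ∀ {m n} → 0 < n → n < m → 𝟙[ m ∣ n ] ≡ + 0
𝟙∣-< {m} {n@(suc _)} _ n<m with m ∣? n
... | yes m∣n = contradiction (∣⇒≤ m∣n) (ℕ.<⇒≱ n<m)
... | no  _   = refl

numer+𝟙∣-1 : ∀ m {j} → 0 < j → j ≤ m → numer j j + 𝟙[ m ∣ j -1] ≡ + 0
numer+𝟙∣-1 m {suc zero}    _ _     = cong (_+_ (numer 1 1)) (𝟙∣0 m)
numer+𝟙∣-1 m {suc (suc j)} _ 2+j≤m = cong (_+_ (+ 0)) (𝟙∣-< (s≤s z≤n) 2+j≤m)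

mbinom-above : ∀ m {n k} → n < k → mbinom m n k ≡ 0
mbinom-above m {zero}  {suc k} _ = refl
mbinom-above m {suc n} {suc k} (s≤s n<k) with k ℕ.≟ n
... | yes refl = contradiction n<k (ℕ.<-irrefl refl)
... | no  _ with k ℕ.<? n
...   | yes k<n = contradiction k<n (ℕ.<-asym n<k)
...   | no  _   = refl

mbinom-diag : ∀ m n → + mbinom m n n ≡ 𝟙[ m ∣ n ]
mbinom-diag m zero    = sym (𝟙∣0 m)
mbinom-diag m (suc n) with n ℕ.≟ n
... | no  n≢n = contradiction refl n≢n
... | yes _ with m ∣? suc n
...   | yes _ = refl
...   | no  _ = refl

mbinom-pascal : ∀ m {n k} → k < n → mbinom m (suc n) (suc k) ≡ mbinom m n (suc k) ℕ.+ mbinom m n k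
mbinom-pascal m {n} {k} k<n with k ℕ.≟ n
... | yes refl = contradiction k<n (ℕ.<-irrefl refl)
... | no  _ with k ℕ.<? n
...   | yes _   = refl
...   | no  k≮n = contradiction k<n k≮n

module _ (m : ℕ) (0<m : 0 < m) (g : Series) (isGm : IsGm m g) where

  defect : Series
  defect = g ⊛ pascal

  defect-fix : ∀ n k → defect n k ≡ numer n k + shift m m defect n k
  defect-fix n k = begin
    defect n k                                  ≡⟨ move (defect n k) (shift m m defect n k) ⟩
    (defect n k - shift m m defect n k) + shift m m defect n k
      ≡⟨ cong (_+ shift m m defect n k) difference ⟩
    numer n k + shift m m defect n k            ∎
    where
    move : ∀ x y → x ≡ (x - y) + y
    move = solve-∀
    difference : defect n k - shift m m defect n k ≡ numer n k
    difference = begin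
      defect n k - shift m m defect n k             ≡⟨ cong (defect n k -_) (⊛-shift m m g pascal n k) ⟨
      (g ⊛ pascal) n k - (g ⊛ shift m m pascal) n k ≡⟨ ⊛-distribˡ-⊖ g pascal (shift m m pascal) n k ⟨
      (g ⊛ (pascal ⊖ shift m m pascal)) n k         ≡⟨ ⊛-congʳ g (denom≈pascal⊖shift m) n k ⟨
      (g ⊛ denom m) n k                             ≡⟨ isGm n k ⟩
      numer n k                                     ∎

  n∸m<n : ∀ {n} → m ≤ n → n ∸ m < n
  n∸m<n m≤n = ℕ.∸-monoʳ-< 0<m m≤n

  defect-offdiag : ∀ n k → n ≢ k → defect n k ≡ + 0
  defect-offdiag = <-rec (λ n → ∀ k → n ≢ k → defect n k ≡ + 0) step
    where
    step : ∀ n → (∀ {n′} → n′ < n → ∀ k → n′ ≢ k → defect n′ k ≡ + 0) →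
           ∀ k → n ≢ k → defect n k ≡ + 0
    step n rec k n≢k = trans (defect-fix n k) (cong₂ _+_ (numer-offdiag n≢k) (shifted (m ≤? n) (m ≤? k)))
      where
      shifted : Dec (m ≤ n) → Dec (m ≤ k) → shift m m defect n k ≡ + 0
      shifted (yes m≤n) (yes m≤k) = trans (shift-≤ m m defect m≤n m≤k)
        (rec (n∸m<n m≤n) (k ∸ m) (n≢k ∘ ℕ.∸-cancelʳ-≡ m≤n m≤k))
      shifted (no m≰n) _          = shift-≰ˡ m m defect m≰n
      shifted (yes _)  (no m≰k)   = shift-≰ʳ m m defect m≰k

  defect-diag-< : ∀ {j} → j < m → defect j j ≡ numer j j
  defect-diag-< {j} j<m =
    trans (defect-fix j j) (trans (cong (_+_ (numer j j)) (shift-≰ˡ m m defect (ℕ.<⇒≱ j<m))) (ℤ.+-identityʳ _))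

  defect-diag-+m : ∀ i → defect (i ℕ.+ m) (i ℕ.+ m) ≡ numer (i ℕ.+ m) (i ℕ.+ m) + defect i i
  defect-diag-+m i = trans (defect-fix (i ℕ.+ m) (i ℕ.+ m)) (cong (_+_ (numer (i ℕ.+ m) (i ℕ.+ m)))
    (trans (shift-≤ m m defect (ℕ.m≤n+m m i) (ℕ.m≤n+m m i)) (cong₂ defect (ℕ.m+n∸n≡m i m) (ℕ.m+n∸n≡m i m))))

  defect-00 : defect 0 0 ≡ + 1
  defect-00 = defect-diag-< 0<m

  DiagValue : ℕ → Set
  DiagValue j = defect j j + 𝟙[ m ∣ j -1] ≡ 𝟙[ m ∣ j ]

  diagValue-< : ∀ {j} → j < m → DiagValue j
  diagValue-< {zero}  _   = trans (ℤ.+-identityʳ _) (trans defect-00 (sym (𝟙∣0 m)))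
  diagValue-< {suc j} j<m = begin
    defect (suc j) (suc j) + 𝟙[ m ∣ j ]       ≡⟨ cong (_+ 𝟙[ m ∣ j ]) (defect-diag-< j<m) ⟩
    numer (suc j) (suc j) + 𝟙[ m ∣ j ]        ≡⟨ numer+𝟙∣-1 m (s≤s z≤n) (ℕ.<⇒≤ j<m) ⟩
    + 0                                        ≡⟨ 𝟙∣-< (s≤s z≤n) j<m ⟨
    𝟙[ m ∣ suc j ]                             ∎

  diagValue-+m : ∀ i → DiagValue i → DiagValue (i ℕ.+ m)
  diagValue-+m zero _ = begin
    defect m m + 𝟙[ m ∣ m -1]                  ≡⟨ cong (_+ 𝟙[ m ∣ m -1]) (defect-diag-+m 0) ⟩
    (numer m m + defect 0 0) + 𝟙[ m ∣ m -1]    ≡⟨ swap (numer m m) (defect 0 0) 𝟙[ m ∣ m -1] ⟩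
    (numer m m + 𝟙[ m ∣ m -1]) + defect 0 0    ≡⟨ cong₂ _+_ (numer+𝟙∣-1 m 0<m ℕ.≤-refl) defect-00 ⟩
    + 1                                        ≡⟨ trans (𝟙∣-periodic m 0) (𝟙∣0 m) ⟨
    𝟙[ m ∣ m ]                                 ∎
    where
    swap : ∀ x y z → (x + y) + z ≡ (x + z) + y
    swap = solve-∀
  diagValue-+m (suc i) value = begin
    defect (suc i ℕ.+ m) (suc i ℕ.+ m) + 𝟙[ m ∣ i ℕ.+ m ]
      ≡⟨ cong₂ _+_ (defect-diag-+m (suc i)) (𝟙∣-periodic m i) ⟩
    (numer (suc i ℕ.+ m) (suc i ℕ.+ m) + defect (suc i) (suc i)) + 𝟙[ m ∣ i ]
      ≡⟨ cong (λ x → (x + defect (suc i) (suc i)) + 𝟙[ m ∣ i ]) (numer-diag-≥2 (s≤s (ℕ.≤-trans 0<m (ℕ.m≤n+m m i)))) ⟩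
    (+ 0 + defect (suc i) (suc i)) + 𝟙[ m ∣ i ]
      ≡⟨ cong (_+ 𝟙[ m ∣ i ]) (ℤ.+-identityˡ (defect (suc i) (suc i))) ⟩
    defect (suc i) (suc i) + 𝟙[ m ∣ i ]
      ≡⟨ value ⟩
    𝟙[ m ∣ suc i ]
      ≡⟨ 𝟙∣-periodic m (suc i) ⟨
    𝟙[ m ∣ suc i ℕ.+ m ] ∎

  diagValue : ∀ j → DiagValue j
  diagValue = <-rec DiagValue step
    where
    step : ∀ j → (∀ {i} → i < j → DiagValue i) → DiagValue j
    step j rec with m ≤? j
    ... | no  m≰j = diagValue-< (ℕ.≰⇒> m≰j)
    ... | yes m≤j = subst DiagValue (ℕ.m∸n+n≡m m≤j) (diagValue-+m (j ∸ m) (rec (n∸m<n m≤j)))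

  mbinom-pascal-defect : ∀ n k →
    defect (suc n) (suc k) + + mbinom m n (suc k) + + mbinom m n k ≡ + mbinom m (suc n) (suc k)
  mbinom-pascal-defect n k with ℕ.<-cmp k n
  ... | tri< k<n _ _ = begin
    defect (suc n) (suc k) + + mbinom m n (suc k) + + mbinom m n k
      ≡⟨ cong (λ x → x + + mbinom m n (suc k) + + mbinom m n k)
              (defect-offdiag (suc n) (suc k) (ℕ.<⇒≢ (s≤s k<n) ∘ sym)) ⟩
    + (mbinom m n (suc k) ℕ.+ mbinom m n k)
      ≡⟨ cong +_ (mbinom-pascal m k<n) ⟨
    + mbinom m (suc n) (suc k) ∎
  ... | tri≈ _ refl _ = begin
    defect (suc n) (suc n) + + mbinom m n (suc n) + + mbinom m n n
      ≡⟨ cong₂ (λ x y → defect (suc n) (suc n) + + x + y) (mbinom-above m {n} ℕ.≤-refl) (mbinom-diag m n) ⟩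
    defect (suc n) (suc n) + + 0 + 𝟙[ m ∣ n ]
      ≡⟨ cong (_+ 𝟙[ m ∣ n ]) (ℤ.+-identityʳ (defect (suc n) (suc n))) ⟩
    defect (suc n) (suc n) + 𝟙[ m ∣ n ]
      ≡⟨ diagValue (suc n) ⟩
    𝟙[ m ∣ suc n ]
      ≡⟨ mbinom-diag m (suc n) ⟨
    + mbinom m (suc n) (suc n) ∎
  ... | tri> _ _ n<k = begin
    defect (suc n) (suc k) + + mbinom m n (suc k) + + mbinom m n k
      ≡⟨ cong₂ (λ x y → x + + mbinom m n (suc k) + + y)
               (defect-offdiag (suc n) (suc k) (ℕ.<⇒≢ (s≤s n<k))) (mbinom-above m n<k) ⟩
    + (mbinom m n (suc k) ℕ.+ 0)
      ≡⟨ cong (λ x → + (x ℕ.+ 0)) (mbinom-above m (ℕ.m<n⇒m<1+n n<k)) ⟩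
    + 0
      ≡⟨ cong +_ (mbinom-above m (s≤s n<k)) ⟨
    + mbinom m (suc n) (suc k) ∎

  g-pascal : ∀ n k → g n k ≡ defect n k + shift 1 0 g n k + shift 1 1 g n k
  g-pascal n k = trans (move (g n k) (shift 1 0 g n k) (shift 1 1 g n k))
    (cong (λ x → x + shift 1 0 g n k + shift 1 1 g n k) (sym (⊛-pascal g n k)))
    where
    move : ∀ x y z → x ≡ (x - y - z) + y + z
    move = solve-∀

  g≡mbinom : ∀ n k → g n k ≡ + mbinom m n k
  g≡mbinom zero k = begin
    g 0 k                                            ≡⟨ g-pascal 0 k ⟩
    defect 0 k + shift 1 0 g 0 k + shift 1 1 g 0 k   ≡⟨ cong₂ (λ x y → defect 0 k + x + y)
                                                          (shift-≰ˡ 1 0 g {0} {k} (λ ())) (shift-≰ˡ 1 1 g {0} {k} (λ ())) ⟩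
    defect 0 k + + 0 + + 0                           ≡⟨ trans (ℤ.+-identityʳ _) (ℤ.+-identityʳ _) ⟩
    defect 0 k                                       ≡⟨ row-0 k ⟩
    + mbinom m 0 k                                   ∎
    where
    row-0 : ∀ k → defect 0 k ≡ + mbinom m 0 k
    row-0 zero    = defect-00
    row-0 (suc k) = defect-offdiag 0 (suc k) (λ ())
  g≡mbinom (suc n) zero = begin
    g (suc n) 0                                                  ≡⟨ g-pascal (suc n) 0 ⟩
    defect (suc n) 0 + shift 1 0 g (suc n) 0 + shift 1 1 g (suc n) 0
      ≡⟨ cong₂ (λ x y → x + shift 1 0 g (suc n) 0 + y) (defect-offdiag (suc n) 0 (λ ())) (shift-≰ʳ 1 1 g {suc n} {0} (λ ())) ⟩
    + 0 + shift 1 0 g (suc n) 0 + + 0                            ≡⟨ cong (λ x → + 0 + x + + 0) (shift-≤ 1 0 g (s≤s z≤n) z≤n) ⟩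
    + 0 + g n 0 + + 0                                            ≡⟨ cong (λ x → + 0 + x + + 0) (g≡mbinom n 0) ⟩
    + 1                                                          ∎
  g≡mbinom (suc n) (suc k) = begin
    g (suc n) (suc k)
      ≡⟨ g-pascal (suc n) (suc k) ⟩
    defect (suc n) (suc k) + shift 1 0 g (suc n) (suc k) + shift 1 1 g (suc n) (suc k)
      ≡⟨ cong₂ (λ x y → defect (suc n) (suc k) + x + y)
               (shift-≤ 1 0 g (s≤s z≤n) z≤n) (shift-≤ 1 1 g (s≤s z≤n) (s≤s z≤n)) ⟩
    defect (suc n) (suc k) + g n (suc k) + g n k
      ≡⟨ cong₂ (λ x y → defect (suc n) (suc k) + x + y) (g≡mbinom n (suc k)) (g≡mbinom n k) ⟩
    defect (suc n) (suc k) + + mbinom m n (suc k) + + mbinom m n k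
      ≡⟨ mbinom-pascal-defect n k ⟩
    + mbinom m (suc n) (suc k) ∎

corollary7 : ∀ (m : ℕ) → 1 ≤ m → ∀ (g : Series) → IsGm m g →
             ∀ (n k : ℕ) → k ≤ n → + (mbinom m n k) ≡ g n k
corollary7 m 1≤m g isGm n k _ = sym (g≡mbinom m 1≤m g isGm n k)
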